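{- Let $k\ge 2$. There is a constant $c=c(k)>0$ such that the following holds. For every $n$ with $(2k-2)\mid(n-1)$, let $\mathcal{T}$ be the $k$-graph of order $n$ consisting of a vertex $v$ and $\frac{n-1}{2k-2}$ arms, where the $i$-th arm has edges $\{v,w_1^i,\dots,w_{k-1}^i\}$ and $\{w_{k-1}^i,w_k^i,\dots,w_{2k-2}^i\}$, all vertices $w_j^i$ being pairwise distinct and distinct from $v$. Then $\mathcal{T}$ is a $k$-uniform $1$-tree and $\hat{R}(\mathcal{T}) \ge c n^2$, i.e. $\hat{R}(\mathcal{T})=\Omega(n^2)$.
   Context: A $k$-graph is a vertex set with a family of $k$-element subsets (edges). A $k$-graph with edge set $\{e_1,\dots,e_m\}$ is an $\ell$-tree if for each $2\le j\le m$, $|e_j\cap\bigcup_{i<j}e_i|\le\ell$ and $e_j\cap\bigcup_{i<j}e_i\subseteq e_{i_0}$ for some $i_0<j$. For $k$-graphs, $\mathcal{H}\to\mathcal{G}$ means every 2-coloring of the edges of $\mathcal{H}$ yields a monochromatic copy of $\mathcal{G}$, and $\hat{R}(\mathcal{G})=\min\{|E(\mathcal{H})|:\mathcal{H}\to\mathcal{G}\}$. -}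

module Defs where

open import Data.Nat using (ℕ; zero; suc; _+_; _*_; _∸_; _≤_; _<_; _≤ᵇ_; _<ᵇ_; _≡ᵇ_)
open import Data.Bool using (Bool; true; false; _∧_; _∨_)
open import Data.Fin using (Fin; toℕ; _≟_)
open import Data.Fin.Subset using (Subset; _∩_; _⊆_; ⋃; ∣_∣)
open import Data.Vec using (tabulate; lookup)
open import Data.List using (List; []; _∷_; length; take; allFin; upTo; concatMap)
open import Data.Bool.ListAction using (any)
import Data.List as L
open import Data.List.Relation.Unary.All using (All)
open import Data.List.Relation.Unary.Any using (Any)
open import Data.List.Relation.Unary.Unique.Propositional using (Unique)
open import Data.List.Relation.Binary.Permutation.Propositional using (_↭_)
open import Data.List.Membership.Propositional using (_∈_)
open import Data.Product using (Σ; ∃; ∃-syntax; _×_)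
open import Function.Definitions using (Injective)
open import Relation.Binary.PropositionalEquality using (_≡_)
open import Relation.Nullary.Decidable using (⌊_⌋)

record Hypergraph : Set where
  constructor hg
  field
    V : ℕ
    E : List (Subset V)
open Hypergraph public

-- H is a k-graph: every edge has exactly k vertices, and edges are distinct
-- (the edge list represents a set of edges).
IsKGraph : ℕ → Hypergraph → Set
IsKGraph k H = All (λ e → ∣ e ∣ ≡ k) (E H) × Unique (E H)

e[_] : Hypergraph → ℕ
e[ H ] = length (E H)

TreeSeq : {V : ℕ} → ℕ → List (Subset V) → Set
TreeSeq ℓ es =
  (j : Fin (length es)) → 1 ≤ toℕ j →
    let ej = L.lookup es j
        pre = take (toℕ j) es
    in (∣ ej ∩ ⋃ pre ∣ ≤ ℓ) × Any (λ ei → (ej ∩ ⋃ pre) ⊆ ei) pre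

IsTree : ℕ → Hypergraph → Set
IsTree ℓ H = Σ (List (Subset (V H))) λ es → (es ↭ E H) × TreeSeq ℓ es

image : {a b : ℕ} → (Fin a → Fin b) → Subset a → Subset b
image {a} f e = tabulate λ y → any (λ x → lookup e x ∧ ⌊ f x ≟ y ⌋) (allFin a)

Colouring : Hypergraph → Set
Colouring H = Fin e[ H ] → Bool

MonoCopy : (G H : Hypergraph) → Colouring H → Set
MonoCopy G H χ =
  Σ Bool λ b → Σ (Fin (V G) → Fin (V H)) λ f → Injective _≡_ _≡_ f ×
    (∀ {e} → e ∈ E G → ∃[ i ] (L.lookup (E H) i ≡ image f e × χ i ≡ b))

Arrows : Hypergraph → Hypergraph → Set
Arrows H G = (χ : Colouring H) → MonoCopy G H χ

-- The k-graph T with m arms on vertex set Fin (1 + m(2k-2)):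
-- v = 0, and w^i_j = 1 + i(2k-2) + (j-1) for i < m, 1 ≤ j ≤ 2k-2.
-- Arm i: {v, w^i_1..w^i_{k-1}} and {w^i_{k-1}, ..., w^i_{2k-2}}.
armOrder : ℕ → ℕ → ℕ
armOrder k m = suc (m * (2 * k ∸ 2))

armEdges : (k m : ℕ) → ℕ → List (Subset (armOrder k m))
armEdges k m i =
  tabulate (λ x → (toℕ x ≡ᵇ 0) ∨ ((base ≤ᵇ toℕ x) ∧ (toℕ x <ᵇ base + (k ∸ 1)))) ∷
  tabulate (λ x → ((base + (k ∸ 2)) ≤ᵇ toℕ x) ∧ (toℕ x <ᵇ base + (2 * k ∸ 2))) ∷ []
  where base = suc (i * (2 * k ∸ 2))

spider : ℕ → ℕ → Hypergraph
spider k m = hg (armOrder k m) (concatMap (armEdges k m) (upTo m))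

module Submission where

-- Colour an edge of H red (true) when it contains a vertex of degree at least m, the number of arms of T.
-- A blue copy of T is impossible: its centre lies in the images of the m inner edges, which are m
-- distinct edges, so the centre has degree at least m and these edges are red.  In a red copy each
-- of the m pairwise disjoint outer edges contains a vertex of degree at least m, and these vertices
-- are distinct, so m² ≤ ∑ deg = k · e(H).  As n = 1 + m(2k-2) ≤ m(2k-1), n² ≤ k(2k-1)² · e(H).

open import Defs
open import Algebra.Properties.CommutativeMonoid.Sum as Sum using ()
open import Data.Bool using (Bool; true; false; T; _∧_; _∨_)
open import Data.Bool.Properties using (T-∧; T-∨; T-≡)
open import Data.Empty using (⊥-elim)
open import Data.Fin using (Fin; zero; suc; toℕ; fromℕ<; punchIn; punchOut)
open import Data.Fin.Properties
  using (toℕ-fromℕ<; toℕ-injective; toℕ<n; punchIn-punchOut; punchOut-injective; any?)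
import Data.Fin.Properties as FinP
open import Data.Fin.Subset using (Subset; ∣_∣; _∈_; _∉_; _∩_; ⋃; _⊆_; ⁅_⁆)
open import Data.Fin.Subset.Properties
  using (_∈?_; x∈p∩q⁻; x∈p∪q⁻; ∉⊥; x∈⁅x⁆; x∈⁅y⁆⇒x≡y; ∣⁅x⁆∣≡1; p⊆q⇒∣p∣≤∣q∣; ⊆-antisym; ⊆-reflexive)
open import Data.List as L using (List; []; _∷_; _++_; length; take; allFin; upTo; concatMap)
import Data.List.Properties as LP
open import Data.List.Membership.Propositional using (lose; find) renaming (_∈_ to _∈ₗ_)
import Data.List.Membership.Propositional.Properties as ∈ₗ
open import Data.List.Relation.Unary.Any as Any using (Any; here; there)
open import Data.List.Relation.Unary.Any.Properties using (any⁺; any⁻)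
open import Data.List.Relation.Unary.All as All using (All)
import Data.List.Relation.Unary.AllPairs as AllPairs
open import Data.List.Relation.Unary.Unique.Propositional using (Unique)
open import Data.List.Relation.Unary.Unique.Propositional.Properties using (++⁺)
open import Data.List.Relation.Binary.Permutation.Propositional using (↭-refl)
open import Data.Nat
open import Data.Nat.Properties
open import Algebra.Properties.CommutativeSemigroup *-commutativeSemigroup using (interchange; xy∙z≈yz∙x)
open import Data.Product using (Σ; ∃-syntax; _×_; _,_; proj₁; proj₂)
open import Data.Sum using (_⊎_; inj₁; inj₂)
open import Data.Vec as V using ([]; _∷_; tabulate)
open import Data.Vec.Properties using (lookup∘tabulate; tabulate-cong; []=⇒lookup; lookup⇒[]=)
open import Function using (_∘_; Equivalence)
open import Function.Definitions using (Injective)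
open import Relation.Binary.PropositionalEquality
open import Relation.Binary.Definitions using (tri<; tri≈; tri>)
open import Relation.Nullary using (¬_)
open import Relation.Nullary.Decidable using (⌊_⌋; _×-dec_; toWitness; fromWitness)

open Sum +-0-commutativeMonoid using (sum; sum-syntax; ∑-comm; sum-remove)
open Equivalence using (to; from)

indicator : Bool → ℕ
indicator true = 1
indicator false = 0

∣p∣≡∑indicator : ∀ {n} (p : Subset n) → ∣ p ∣ ≡ sum (λ x → indicator (V.lookup p x))
∣p∣≡∑indicator [] = refl
∣p∣≡∑indicator (true ∷ p) = cong suc (∣p∣≡∑indicator p)
∣p∣≡∑indicator (false ∷ p) = ∣p∣≡∑indicator p

∑-cong : ∀ {n} {v w : Fin n → ℕ} → (∀ x → v x ≡ w x) → sum v ≡ sum w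
∑-cong {zero} e = refl
∑-cong {suc n} e = cong₂ _+_ (e zero) (∑-cong (e ∘ suc))

∑-const : ∀ n c → sum {n} (λ _ → c) ≡ n * c
∑-const zero c = refl
∑-const (suc n) c = cong (c +_) (∑-const n c)

∑-lowerBound : ∀ {n} c (w : Fin n → ℕ) → (∀ x → c ≤ w x) → n * c ≤ sum w
∑-lowerBound {zero} c w h = z≤n
∑-lowerBound {suc n} c w h = +-mono-≤ (h zero) (∑-lowerBound c (w ∘ suc) (h ∘ suc))

∑-injective-≤ : ∀ {m n} (h : Fin m → Fin n) → Injective _≡_ _≡_ h → (w : Fin n → ℕ) →
                sum (w ∘ h) ≤ sum w
∑-injective-≤ {zero} h h-inj w = z≤n
∑-injective-≤ {suc m} {zero} h h-inj w with h zero
... | ()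
∑-injective-≤ {suc m} {suc n} h h-inj w = begin
  w (h zero) + sum (w ∘ h ∘ suc)
    ≡⟨ cong (w (h zero) +_) (∑-cong (cong w ∘ sym ∘ punchIn-punchOut ∘ h₀≢)) ⟩
  w (h zero) + sum (w ∘ punchIn (h zero) ∘ h′)
    ≤⟨ +-monoʳ-≤ (w (h zero)) (∑-injective-≤ h′ h′-inj (w ∘ punchIn (h zero))) ⟩
  w (h zero) + sum (w ∘ punchIn (h zero))
    ≡⟨ sum-remove w ⟨
  sum w ∎
  where
  open ≤-Reasoning
  h₀≢ : ∀ j → h zero ≢ h (suc j)
  h₀≢ j eq = FinP.0≢1+n (h-inj eq)
  h′ : Fin m → Fin n
  h′ j = punchOut (h₀≢ j)
  h′-inj : Injective _≡_ _≡_ h′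
  h′-inj {i} {j} eq = FinP.suc-injective (h-inj (punchOut-injective (h₀≢ i) (h₀≢ j) eq))

∈⇒lookup : ∀ {n} {p : Subset n} {x} → x ∈ p → T (V.lookup p x)
∈⇒lookup x∈p = from T-≡ ([]=⇒lookup x∈p)

lookup⇒∈ : ∀ {n} {p : Subset n} {x} → T (V.lookup p x) → x ∈ p
lookup⇒∈ {p = p} {x} t = lookup⇒[]= x p (to T-≡ t)

∈-tabulate⁺ : ∀ {n} (g : Fin n → Bool) {x} → T (g x) → x ∈ tabulate g
∈-tabulate⁺ g {x} t = lookup⇒∈ (subst T (sym (lookup∘tabulate g x)) t)

∈-tabulate⁻ : ∀ {n} (g : Fin n → Bool) {x} → x ∈ tabulate g → T (g x)
∈-tabulate⁻ g {x} x∈g = subst T (lookup∘tabulate g x) (∈⇒lookup x∈g)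

inRange : ℕ → ℕ → ℕ → Bool
inRange a b y = (a ≤ᵇ y) ∧ (y <ᵇ b)

inRange⁺ : ∀ {a b y} → a ≤ y → y < b → T (inRange a b y)
inRange⁺ a≤y y<b = from T-∧ (≤⇒≤ᵇ a≤y , <⇒<ᵇ y<b)

inRange⁻ : ∀ {a b y} → T (inRange a b y) → a ≤ y × y < b
inRange⁻ {a} {b} {y} t with to T-∧ t
... | a≤ᵇy , y<ᵇb = ≤ᵇ⇒≤ a y a≤ᵇy , <ᵇ⇒< y b y<ᵇb

∣inRange∣ : ∀ {n} a b → a ≤ b → b ≤ n → ∣ tabulate {n = n} (inRange a b ∘ toℕ) ∣ ≡ b ∸ a
∣inRange∣ {zero} a zero _ _ = sym (0∸n≡0 a)
∣inRange∣ {suc n} zero zero _ _ = ∣inRange∣ {n} 0 0 z≤n z≤n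
∣inRange∣ {suc n} zero (suc b) _ (s≤s b≤n) = cong suc (∣inRange∣ 0 b z≤n b≤n)
∣inRange∣ {suc n} (suc a) (suc b) (s≤s a≤b) (s≤s b≤n) =
  trans (cong ∣_∣ (tabulate-cong {n = n} λ x → cong (_∧ (toℕ x <ᵇ b)) (<ᵇ-suc a (toℕ x))))
        (∣inRange∣ a b a≤b b≤n)
  where
  <ᵇ-suc : ∀ a y → (a <ᵇ suc y) ≡ (a ≤ᵇ y)
  <ᵇ-suc zero y = refl
  <ᵇ-suc (suc a) y = refl

module _ {a b : ℕ} (f : Fin a → Fin b) where

  image⁺ : ∀ {p x} → x ∈ p → f x ∈ image f p
  image⁺ {p} {x} x∈p =
    ∈-tabulate⁺ _ (any⁺ _ (lose (∈ₗ.∈-allFin x) (from T-∧ (∈⇒lookup x∈p , fromWitness refl))))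

  image⁻ : ∀ {p y} → y ∈ image f p → ∃[ x ] x ∈ p × f x ≡ y
  image⁻ y∈fp with Any.satisfied (any⁻ _ (allFin a) (∈-tabulate⁻ _ y∈fp))
  ... | x , t with to T-∧ t
  ... | x∈p , fx≡y = x , lookup⇒∈ x∈p , toWitness fx≡y

  image-⊆⁻ : Injective _≡_ _≡_ f → ∀ {p q} → image f p ⊆ image f q → p ⊆ q
  image-⊆⁻ f-inj sub x∈p with image⁻ (sub (image⁺ x∈p))
  ... | x′ , x′∈q , fx′≡fx with f-inj fx′≡fx
  ... | refl = x′∈q

  image-injective : Injective _≡_ _≡_ f → Injective _≡_ _≡_ (image f)
  image-injective f-inj eq =
    ⊆-antisym (image-⊆⁻ f-inj (⊆-reflexive eq)) (image-⊆⁻ f-inj (⊆-reflexive (sym eq)))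

TreeStep : ∀ {n} → ℕ → Subset n → List (Subset n) → Set
TreeStep ℓ e pre = (∣ e ∩ ⋃ pre ∣ ≤ ℓ) × Any (λ ei → e ∩ ⋃ pre ⊆ ei) pre

TreeStep-⊆⁅⁆ : ∀ {n} {e e′ : Subset n} {pre x} →
               e ∩ ⋃ pre ⊆ ⁅ x ⁆ → e′ ∈ₗ pre → x ∈ e′ → TreeStep 1 e pre
TreeStep-⊆⁅⁆ {x = x} sub e′∈pre x∈e′ =
  ≤-trans (p⊆q⇒∣p∣≤∣q∣ sub) (≤-reflexive (∣⁅x⁆∣≡1 x)) ,
  lose e′∈pre (λ h → subst (_∈ _) (sym (x∈⁅y⁆⇒x≡y x (sub h))) x∈e′)

⋃⁻ : ∀ {n} {x : Fin n} (ps : List (Subset n)) → x ∈ ⋃ ps → ∃[ e ] e ∈ₗ ps × x ∈ e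
⋃⁻ [] x∈⊥ = ⊥-elim (∉⊥ x∈⊥)
⋃⁻ (p ∷ ps) x∈⋃ with x∈p∪q⁻ p (⋃ ps) x∈⋃
... | inj₁ x∈p = p , here refl , x∈p
... | inj₂ x∈⋃ps with ⋃⁻ ps x∈⋃ps
...   | e , e∈ps , x∈e = e , there e∈ps , x∈e

module _ {A : Set} where

  lookup-++ˡ : ∀ (xs ys : List A) (j : Fin (length (xs ++ ys))) (j< : toℕ j < length xs) →
               L.lookup (xs ++ ys) j ≡ L.lookup xs (fromℕ< j<)
  lookup-++ˡ (x ∷ xs) ys zero j< = refl
  lookup-++ˡ (x ∷ xs) ys (suc j) (s≤s j<) = lookup-++ˡ xs ys j j<

  lookup-∷ʳ-last : ∀ (xs : List A) y (j : Fin (length (xs ++ y ∷ []))) →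
                   toℕ j ≡ length xs → L.lookup (xs ++ y ∷ []) j ≡ y
  lookup-∷ʳ-last [] y zero _ = refl
  lookup-∷ʳ-last (x ∷ xs) y (suc j) eq = lookup-∷ʳ-last xs y j (suc-injective eq)

  take-++ˡ : ∀ t (xs ys : List A) → t ≤ length xs → take t (xs ++ ys) ≡ take t xs
  take-++ˡ zero xs ys _ = refl
  take-++ˡ (suc t) (x ∷ xs) ys (s≤s t≤) = cong (x ∷_) (take-++ˡ t xs ys t≤)

TreeSeq-∷ʳ : ∀ {n} {ℓ} (xs : List (Subset n)) y →
             TreeSeq ℓ xs → (1 ≤ length xs → TreeStep ℓ y xs) → TreeSeq ℓ (xs ++ y ∷ [])
TreeSeq-∷ʳ {ℓ = ℓ} xs y tree step j 1≤j with m≤n⇒m<n∨m≡n j≤∣xs∣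
  where
  j≤∣xs∣ : toℕ j ≤ length xs
  j≤∣xs∣ = s≤s⁻¹ (subst (toℕ j <_) (trans (LP.length-++ xs) (+-comm (length xs) 1)) (toℕ<n j))
... | inj₁ j< =
  subst₂ (TreeStep ℓ) (sym (lookup-++ˡ xs (y ∷ []) j j<)) (sym prefix) (tree j′ (subst (1 ≤_) (sym j′≡j) 1≤j))
  where
  j′ = fromℕ< j<
  j′≡j : toℕ j′ ≡ toℕ j
  j′≡j = toℕ-fromℕ< j<
  prefix : take (toℕ j) (xs ++ y ∷ []) ≡ take (toℕ j′) xs
  prefix = trans (take-++ˡ (toℕ j) xs (y ∷ []) (<⇒≤ j<)) (cong (λ t → take t xs) (sym j′≡j))
... | inj₂ j≡ =
  subst₂ (TreeStep ℓ) (sym (lookup-∷ʳ-last xs y j j≡)) (sym prefix) (step (subst (1 ≤_) j≡ 1≤j))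
  where
  prefix : take (toℕ j) (xs ++ y ∷ []) ≡ xs
  prefix = trans (take-++ˡ (toℕ j) xs (y ∷ []) (≤-reflexive j≡))
                 (trans (cong (λ t → take t xs) j≡) (LP.take-all (length xs) xs ≤-refl))

module Degrees (H : Hypergraph) where

  edge : Fin e[ H ] → Subset (V H)
  edge = L.lookup (E H)

  degree : Fin (V H) → ℕ
  degree x = ∑[ i < e[ H ] ] indicator (V.lookup (edge i) x)

  handshake : ∀ {k} → All (λ e → ∣ e ∣ ≡ k) (E H) → sum degree ≡ e[ H ] * k
  handshake {k} sizes = begin
    sum degree                                                   ≡⟨ ∑-comm (λ x i → indicator (V.lookup (edge i) x)) ⟩
    ∑[ i < e[ H ] ] ∑[ x < V H ] indicator (V.lookup (edge i) x) ≡⟨ ∑-cong (sym ∘ ∣p∣≡∑indicator ∘ edge) ⟩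
    ∑[ i < e[ H ] ] ∣ edge i ∣                                   ≡⟨ ∑-cong (All.lookup sizes ∘ ∈ₗ.∈-lookup) ⟩
    ∑[ i < e[ H ] ] k                                            ≡⟨ ∑-const e[ H ] k ⟩
    e[ H ] * k                                                   ∎
    where open ≡-Reasoning

  degree-≥ : ∀ {t} (h : Fin t → Fin e[ H ]) → Injective _≡_ _≡_ h →
             ∀ {x} → (∀ j → x ∈ edge (h j)) → t ≤ degree x
  degree-≥ {t} h h-inj {x} x∈ = begin
    t                                                  ≡⟨ *-identityʳ t ⟨
    t * 1                                              ≤⟨ ∑-lowerBound 1 _ (indicator-T ∘ ∈⇒lookup ∘ x∈) ⟩
    sum (λ j → indicator (V.lookup (edge (h j)) x))    ≤⟨ ∑-injective-≤ h h-inj _ ⟩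
    degree x                                           ∎
    where
    open ≤-Reasoning
    indicator-T : ∀ {b} → T b → 1 ≤ indicator b
    indicator-T {true} _ = ≤-refl

  manyHeavyVertices : ∀ {k t} → All (λ e → ∣ e ∣ ≡ k) (E H) →
                      (s : Fin t → Fin (V H)) → Injective _≡_ _≡_ s → (∀ j → t ≤ degree (s j)) →
                      t * t ≤ e[ H ] * k
  manyHeavyVertices {k} {t} sizes s s-inj heavy = begin
    t * t            ≤⟨ ∑-lowerBound t (degree ∘ s) heavy ⟩
    sum (degree ∘ s) ≤⟨ ∑-injective-≤ s s-inj degree ⟩
    sum degree       ≡⟨ handshake sizes ⟩
    e[ H ] * k       ∎
    where open ≤-Reasoning

  heavyColouring : ℕ → Colouring H
  heavyColouring t i = ⌊ any? (λ x → x ∈? edge i ×-dec t ≤? degree x) ⌋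

  heavyColouring⁺ : ∀ {t i x} → x ∈ edge i → t ≤ degree x → heavyColouring t i ≡ true
  heavyColouring⁺ x∈e heavy = to T-≡ (fromWitness (_ , x∈e , heavy))

  heavyColouring⁻ : ∀ {t i} → heavyColouring t i ≡ true → ∃[ x ] x ∈ edge i × t ≤ degree x
  heavyColouring⁻ red = toWitness (from T-≡ red)

module Spider (q m : ℕ) where

  k : ℕ
  k = 2 + q

  L : ℕ
  L = 2 * k ∸ 2

  N : ℕ
  N = armOrder k m

  base : ℕ → ℕ
  base i = suc (i * L)

  inInner : ℕ → ℕ → Bool
  inInner i y = (y ≡ᵇ 0) ∨ inRange (base i) (base i + suc q) y

  inOuter : ℕ → ℕ → Bool
  inOuter i = inRange (base i + q) (base i + L)

  -- innerEdge i and outerEdge i are definitionally the two edges of armEdges k m i.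
  innerEdge : ℕ → Subset N
  innerEdge i = tabulate (inInner i ∘ toℕ)

  outerEdge : ℕ → Subset N
  outerEdge i = tabulate (inOuter i ∘ toℕ)

  L≡q+k : L ≡ q + k
  L≡q+k = cong (λ z → q + suc (suc z)) (+-identityʳ q)

  q<L : q < L
  q<L = subst (q <_) (sym L≡q+k) (m<m+n q z<s)

  later-arm : ∀ {i j} → i < j → base i + L ≤ base j
  later-arm {i} {j} i<j = s≤s (subst (_≤ j * L) (+-comm L (i * L)) (*-monoˡ-≤ L i<j))

  arm-fits : ∀ {i} → i < m → base i + L ≤ N
  arm-fits = later-arm

  record InArm (i y : ℕ) : Set where
    constructor _,_
    field
      lower : base i ≤ y
      upper : y < base i + L

  InArm-unique : ∀ {i j y} → InArm i y → InArm j y → i ≡ j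
  InArm-unique {i} {j} {y} (i≤y , y<i) (j≤y , y<j) with <-cmp i j
  ... | tri< i<j _ _ = ⊥-elim (n≮n y (<-≤-trans y<i (≤-trans (later-arm i<j) j≤y)))
  ... | tri≈ _ i≡j _ = i≡j
  ... | tri> _ _ j<i = ⊥-elim (n≮n y (<-≤-trans y<j (≤-trans (later-arm j<i) i≤y)))

  ∣innerEdge∣ : ∀ {i} → i < m → ∣ innerEdge i ∣ ≡ k
  -- The centre contributes the leading suc; the other vertices form a range.
  ∣innerEdge∣ {i} i<m = cong suc (begin
    ∣ tabulate {n = N} (inRange (base i) (base i + suc q) ∘ toℕ) ∣
      ≡⟨ ∣inRange∣ _ _ (m≤m+n (base i) (suc q)) (≤-trans (+-monoʳ-≤ (base i) q<L) (arm-fits i<m)) ⟩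
    base i + suc q ∸ base i ≡⟨ m+n∸m≡n (base i) (suc q) ⟩
    suc q                   ∎)
    where open ≡-Reasoning

  ∣outerEdge∣ : ∀ {i} → i < m → ∣ outerEdge i ∣ ≡ k
  ∣outerEdge∣ {i} i<m = begin
    ∣ outerEdge i ∣           ≡⟨ ∣inRange∣ _ _ (+-monoʳ-≤ (base i) (<⇒≤ q<L)) (arm-fits i<m) ⟩
    base i + L ∸ (base i + q) ≡⟨ [m+n]∸[m+o]≡n∸o (base i) L q ⟩
    L ∸ q                     ≡⟨ cong (_∸ q) L≡q+k ⟩
    q + k ∸ q                 ≡⟨ m+n∸m≡n q k ⟩
    k                         ∎
    where open ≡-Reasoning

  centre∈innerEdge : ∀ i → zero ∈ innerEdge i
  centre∈innerEdge i = ∈-tabulate⁺ (inInner i ∘ toℕ) _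

  centre∉outerEdge : ∀ i → zero ∉ outerEdge i
  centre∉outerEdge i = ∈-tabulate⁻ (inOuter i ∘ toℕ)

  innerEdge⁺ : ∀ i {x} → base i ≤ toℕ x → toℕ x < base i + suc q → x ∈ innerEdge i
  innerEdge⁺ i b≤x x<b+k-1 = ∈-tabulate⁺ (inInner i ∘ toℕ) (from T-∨ (inj₂ (inRange⁺ b≤x x<b+k-1)))

  innerEdge⁻ : ∀ i {x} → x ∈ innerEdge i → toℕ x ≡ 0 ⊎ base i ≤ toℕ x × toℕ x < base i + suc q
  innerEdge⁻ i {x} x∈e with to T-∨ (∈-tabulate⁻ (inInner i ∘ toℕ) x∈e)
  ... | inj₁ x≡ᵇ0 = inj₁ (≡ᵇ⇒≡ (toℕ x) 0 x≡ᵇ0)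
  ... | inj₂ x∈range = inj₂ (inRange⁻ x∈range)

  outerEdge⁺ : ∀ i {x} → base i + q ≤ toℕ x → toℕ x < base i + L → x ∈ outerEdge i
  outerEdge⁺ i b+q≤x x<b+L = ∈-tabulate⁺ (inOuter i ∘ toℕ) (inRange⁺ b+q≤x x<b+L)

  outerEdge⁻ : ∀ i {x} → x ∈ outerEdge i → base i + q ≤ toℕ x × toℕ x < base i + L
  outerEdge⁻ i x∈e = inRange⁻ (∈-tabulate⁻ (inOuter i ∘ toℕ) x∈e)

  outerEdge-noncentre : ∀ i {x} → x ∈ outerEdge i → 0 < toℕ x
  outerEdge-noncentre i x∈e = <-≤-trans z<s (proj₁ (outerEdge⁻ i x∈e))

  data ArmEdge (i : ℕ) : Subset N → Set where
    inner : ArmEdge i (innerEdge i)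
    outer : ArmEdge i (outerEdge i)

  armEdge-InArm : ∀ {i e x} → ArmEdge i e → x ∈ e → 0 < toℕ x → InArm i (toℕ x)
  armEdge-InArm {i} inner x∈e 0<x with innerEdge⁻ i x∈e
  ... | inj₁ x≡0 = ⊥-elim (<⇒≢ 0<x (sym x≡0))
  ... | inj₂ (b≤x , x<b+k-1) = b≤x , <-≤-trans x<b+k-1 (+-monoʳ-≤ (base i) q<L)
  armEdge-InArm {i} outer x∈e _ with outerEdge⁻ i x∈e
  ... | b+q≤x , x<b+L = ≤-trans (m≤m+n (base i) q) b+q≤x , x<b+L

  sharedVertex-sameArm : ∀ {i j e e′ x} → ArmEdge i e → ArmEdge j e′ →
                         x ∈ e → x ∈ e′ → 0 < toℕ x → i ≡ j
  sharedVertex-sameArm ae ae′ x∈e x∈e′ 0<x =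
    InArm-unique (armEdge-InArm ae x∈e 0<x) (armEdge-InArm ae′ x∈e′ 0<x)

  -- joint i<m is the vertex w^i_{k-1}, shared by the two edges of arm i.
  joint<N : ∀ {i} → i < m → base i + q < N
  joint<N {i} i<m = <-≤-trans (+-monoʳ-< (base i) q<L) (arm-fits i<m)

  joint : ∀ {i} → i < m → Fin N
  joint i<m = fromℕ< (joint<N i<m)

  toℕ-joint : ∀ {i} (i<m : i < m) → toℕ (joint i<m) ≡ base i + q
  toℕ-joint i<m = toℕ-fromℕ< (joint<N i<m)

  joint∈armEdge : ∀ {i e} (i<m : i < m) → ArmEdge i e → joint i<m ∈ e
  joint∈armEdge {i} i<m inner =
    innerEdge⁺ i (subst (base i ≤_) (sym (toℕ-joint i<m)) (m≤m+n (base i) q))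
               (subst (_< base i + suc q) (sym (toℕ-joint i<m)) (+-monoʳ-< (base i) ≤-refl))
  joint∈armEdge {i} i<m outer =
    outerEdge⁺ i (≤-reflexive (sym (toℕ-joint i<m)))
               (subst (_< base i + L) (sym (toℕ-joint i<m)) (+-monoʳ-< (base i) q<L))

  armEdge-unique : ∀ {i j e} → i < m → ArmEdge i e → ArmEdge j e → i ≡ j
  armEdge-unique i<m ae ae′ =
    sharedVertex-sameArm ae ae′ (joint∈armEdge i<m ae) (joint∈armEdge i<m ae)
                         (subst (0 <_) (sym (toℕ-joint i<m)) z<s)

  innerEdge≢outerEdge : ∀ i j → innerEdge i ≢ outerEdge j
  innerEdge≢outerEdge i j eq = centre∉outerEdge j (subst (zero ∈_) eq (centre∈innerEdge i))

  arms : ℕ → List (Subset N)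
  arms n = concatMap (armEdges k m) (upTo n)

  arms-∷ʳ : ∀ n → arms (suc n) ≡ arms n ++ innerEdge n ∷ outerEdge n ∷ []
  arms-∷ʳ n = begin
    concatMap (armEdges k m) (upTo (suc n))      ≡⟨ cong (concatMap (armEdges k m)) (LP.upTo-∷ʳ n) ⟨
    concatMap (armEdges k m) (upTo n ++ n ∷ [])  ≡⟨ LP.concatMap-++ (armEdges k m) (upTo n) (n ∷ []) ⟩
    arms n ++ (innerEdge n ∷ outerEdge n ∷ [])   ∎
    where open ≡-Reasoning

  ∈armEdges⁺ : ∀ {i e} → ArmEdge i e → e ∈ₗ armEdges k m i
  ∈armEdges⁺ inner = here refl
  ∈armEdges⁺ outer = there (here refl)

  ∈armEdges⁻ : ∀ {i e} → e ∈ₗ armEdges k m i → ArmEdge i e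
  ∈armEdges⁻ (here refl) = inner
  ∈armEdges⁻ (there (here refl)) = outer

  ∈arms⁺ : ∀ {n i e} → i < n → ArmEdge i e → e ∈ₗ arms n
  ∈arms⁺ i<n ae = ∈ₗ.∈-concatMap⁺ (armEdges k m) (lose (∈ₗ.∈-upTo⁺ i<n) (∈armEdges⁺ ae))

  ∈arms⁻ : ∀ {n e} → e ∈ₗ arms n → ∃[ i ] i < n × ArmEdge i e
  ∈arms⁻ {n} e∈arms with find (∈ₗ.∈-concatMap⁻ (armEdges k m) {xs = upTo n} e∈arms)
  ... | i , i∈upTo , e∈armEdges = i , ∈ₗ.∈-upTo⁻ i∈upTo , ∈armEdges⁻ e∈armEdges

  armEdge-size : ∀ {i e} → i < m → ArmEdge i e → ∣ e ∣ ≡ k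
  armEdge-size i<m inner = ∣innerEdge∣ i<m
  armEdge-size i<m outer = ∣outerEdge∣ i<m

  arms-unique : ∀ n → n ≤ m → Unique (arms n)
  arms-unique zero _ = AllPairs.[]
  arms-unique (suc n) n<m =
    subst Unique (sym (arms-∷ʳ n)) (++⁺ (arms-unique n (<⇒≤ n<m)) newArm-unique newArm-fresh)
    where
    newArm-unique : Unique (armEdges k m n)
    newArm-unique = (innerEdge≢outerEdge n n All.∷ All.[]) AllPairs.∷ All.[] AllPairs.∷ AllPairs.[]
    newArm-fresh : ∀ {e} → ¬ (e ∈ₗ arms n × e ∈ₗ armEdges k m n)
    newArm-fresh (e∈arms , e∈new) with ∈arms⁻ e∈arms
    ... | i , i<n , ae = <⇒≢ i<n (armEdge-unique (<-trans i<n n<m) ae (∈armEdges⁻ e∈new))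

  spider-isKGraph : IsKGraph k (spider k m)
  spider-isKGraph = All.tabulate size , arms-unique m ≤-refl
    where
    size : ∀ {e} → e ∈ₗ arms m → ∣ e ∣ ≡ k
    size e∈arms with ∈arms⁻ e∈arms
    ... | i , i<m , ae = armEdge-size i<m ae

  earlierArms-avoid : ∀ {n x e} → InArm n (toℕ x) → 0 < toℕ x → e ∈ₗ arms n → x ∉ e
  earlierArms-avoid inArm 0<x e∈arms x∈e with ∈arms⁻ e∈arms
  ... | i , i<n , ae = <⇒≢ i<n (InArm-unique (armEdge-InArm ae x∈e 0<x) inArm)

  innerEdge-overlap : ∀ n → innerEdge n ∩ ⋃ (arms n) ⊆ ⁅ zero ⁆
  innerEdge-overlap n {zero} _ = x∈⁅x⁆ zero
  innerEdge-overlap n {suc x} x∈∩ with x∈p∩q⁻ (innerEdge n) _ x∈∩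
  ... | x∈inner , x∈⋃ with ⋃⁻ (arms n) x∈⋃
  ... | e , e∈arms , x∈e =
    ⊥-elim (earlierArms-avoid {n} (armEdge-InArm inner x∈inner z<s) z<s e∈arms x∈e)

  outerEdge-overlap : ∀ {n} (n<m : n < m) →
                      outerEdge n ∩ ⋃ (arms n ++ innerEdge n ∷ []) ⊆ ⁅ joint n<m ⁆
  outerEdge-overlap {n} n<m {x} x∈∩ with x∈p∩q⁻ (outerEdge n) _ x∈∩
  ... | x∈outer , x∈⋃ with ⋃⁻ (arms n ++ innerEdge n ∷ []) x∈⋃
  ... | e , e∈pre , x∈e with ∈ₗ.∈-++⁻ (arms n) e∈pre
  ...   | inj₁ e∈arms =
    ⊥-elim (earlierArms-avoid {n} (armEdge-InArm outer x∈outer 0<x) 0<x e∈arms x∈e)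
    where 0<x = outerEdge-noncentre n x∈outer
  ...   | inj₂ (here refl) with innerEdge⁻ n x∈e
  ...     | inj₁ x≡0 = ⊥-elim (centre∉outerEdge n (subst (_∈ outerEdge n) (toℕ-injective x≡0) x∈outer))
  ...     | inj₂ (_ , x<b+k-1) = subst (_∈ ⁅ joint n<m ⁆) (sym x≡joint) (x∈⁅x⁆ (joint n<m))
    where
    x≡joint : x ≡ joint n<m
    x≡joint = toℕ-injective (trans (≤-antisym (s≤s⁻¹ (subst (toℕ x <_) (+-suc (base n) q) x<b+k-1))
                                              (proj₁ (outerEdge⁻ n x∈outer)))
                                   (sym (toℕ-joint n<m)))

  innerEdge-treeStep : ∀ n → 1 ≤ length (arms n) → TreeStep 1 (innerEdge n) (arms n)
  innerEdge-treeStep (suc n) _ =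
    TreeStep-⊆⁅⁆ (innerEdge-overlap (suc n)) (∈arms⁺ {suc n} {0} z<s inner) (centre∈innerEdge 0)

  outerEdge-treeStep : ∀ {n} (n<m : n < m) → TreeStep 1 (outerEdge n) (arms n ++ innerEdge n ∷ [])
  outerEdge-treeStep {n} n<m =
    TreeStep-⊆⁅⁆ (outerEdge-overlap n<m) (∈ₗ.∈-++⁺ʳ (arms n) (here refl)) (joint∈armEdge n<m inner)

  arms-treeSeq : ∀ n → n ≤ m → TreeSeq 1 (arms n)
  arms-treeSeq zero _ ()
  arms-treeSeq (suc n) n<m =
    subst (TreeSeq 1) (sym (trans (arms-∷ʳ n) (sym (LP.++-assoc (arms n) _ _))))
      (TreeSeq-∷ʳ _ (outerEdge n)
        (TreeSeq-∷ʳ (arms n) (innerEdge n) (arms-treeSeq n (<⇒≤ n<m)) (innerEdge-treeStep n))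
        (λ _ → outerEdge-treeStep n<m))

  spider-isTree : IsTree 1 (spider k m)
  spider-isTree = arms m , ↭-refl , arms-treeSeq m ≤-refl

  module _ {H : Hypergraph} (sizes : All (λ e → ∣ e ∣ ≡ k) (E H)) where
    open Degrees H

    CopyWithColour : Bool → (Fin N → Fin (V H)) → Set
    CopyWithColour b f = ∀ {e} → e ∈ₗ arms m → ∃[ i ] edge i ≡ image f e × heavyColouring m i ≡ b

    noBlueCopy : 1 ≤ m → ∀ {f} → Injective _≡_ _≡_ f → ¬ CopyWithColour false f
    noBlueCopy 1≤m {f} f-inj copy with copy (∈arms⁺ 1≤m inner)
    ... | i₀ , image₀ , blue =
      true≢false (trans (sym (heavyColouring⁺ (centre∈ 0 i₀ image₀) centre-heavy)) blue)
      where
      true≢false : true ≢ false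
      true≢false ()
      centre∈ : ∀ j i → edge i ≡ image f (innerEdge j) → f zero ∈ edge i
      centre∈ j i eq = subst (f zero ∈_) (sym eq) (image⁺ f (centre∈innerEdge j))
      innerCopy : Fin m → Fin e[ H ]
      innerCopy j = proj₁ (copy (∈arms⁺ (toℕ<n j) inner))
      innerCopy-image : ∀ j → edge (innerCopy j) ≡ image f (innerEdge (toℕ j))
      innerCopy-image j = proj₁ (proj₂ (copy (∈arms⁺ (toℕ<n j) inner)))
      innerCopy-injective : Injective _≡_ _≡_ innerCopy
      innerCopy-injective {j} {j′} eq =
        toℕ-injective (armEdge-unique (toℕ<n j) inner (subst (ArmEdge (toℕ j′)) (sym inner≡) inner))
        where
        inner≡ : innerEdge (toℕ j) ≡ innerEdge (toℕ j′)
        inner≡ = image-injective f f-inj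
                   (trans (sym (innerCopy-image j)) (trans (cong edge eq) (innerCopy-image j′)))
      centre-heavy : m ≤ degree (f zero)
      centre-heavy =
        degree-≥ innerCopy innerCopy-injective (λ j → centre∈ (toℕ j) (innerCopy j) (innerCopy-image j))

    redCopy-bound : ∀ {f} → Injective _≡_ _≡_ f → CopyWithColour true f → m * m ≤ e[ H ] * k
    redCopy-bound {f} f-inj copy =
      manyHeavyVertices sizes heavy heavy-injective (proj₂ ∘ proj₂ ∘ heavyWitness)
      where
      outerCopy : ∀ (j : Fin m) → ∃[ i ] edge i ≡ image f (outerEdge (toℕ j)) × heavyColouring m i ≡ true
      outerCopy j = copy (∈arms⁺ (toℕ<n j) outer)
      heavyWitness : ∀ j → ∃[ x ] x ∈ edge (proj₁ (outerCopy j)) × m ≤ degree x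
      heavyWitness j = heavyColouring⁻ (proj₂ (proj₂ (outerCopy j)))
      heavy : Fin m → Fin (V H)
      heavy j = proj₁ (heavyWitness j)
      heavy-preimage : ∀ j → ∃[ t ] t ∈ outerEdge (toℕ j) × f t ≡ heavy j
      heavy-preimage j =
        image⁻ f (subst (heavy j ∈_) (proj₁ (proj₂ (outerCopy j))) (proj₁ (proj₂ (heavyWitness j))))
      heavy-injective : Injective _≡_ _≡_ heavy
      heavy-injective {j} {j′} eq =
        toℕ-injective (sharedVertex-sameArm outer outer
                         t∈e (subst (_∈ outerEdge (toℕ j′)) (sym t≡t′) t′∈e′) (outerEdge-noncentre (toℕ j) t∈e))
        where
        t = proj₁ (heavy-preimage j)
        t∈e = proj₁ (proj₂ (heavy-preimage j))
        t′ = proj₁ (heavy-preimage j′)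
        t′∈e′ = proj₁ (proj₂ (heavy-preimage j′))
        t≡t′ : t ≡ t′
        t≡t′ = f-inj (trans (proj₂ (proj₂ (heavy-preimage j)))
                            (trans eq (sym (proj₂ (proj₂ (heavy-preimage j′))))))

    spider-lowerBound : 1 ≤ m → Arrows H (spider k m) → m * m ≤ e[ H ] * k
    spider-lowerBound 1≤m arrows with arrows (heavyColouring m)
    ... | false , f , f-inj , copy = ⊥-elim (noBlueCopy 1≤m f-inj copy)
    ... | true , f , f-inj , copy = redCopy-bound f-inj copy

order²-bound : ∀ {m e} L k → 1 ≤ m → m * m ≤ e * k → suc (m * L) ^ 2 ≤ k * (suc L * suc L) * e
order²-bound {m} {e} L k 1≤m mm≤ek = begin
  suc (m * L) ^ 2              ≡⟨ cong (suc (m * L) *_) (*-identityʳ (suc (m * L))) ⟩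
  suc (m * L) * suc (m * L)    ≤⟨ *-mono-≤ n≤m[L+1] n≤m[L+1] ⟩
  m * suc L * (m * suc L)      ≡⟨ interchange m (suc L) m (suc L) ⟩
  m * m * (suc L * suc L)      ≤⟨ *-monoˡ-≤ (suc L * suc L) mm≤ek ⟩
  e * k * (suc L * suc L)      ≡⟨ xy∙z≈yz∙x e k (suc L * suc L) ⟩
  k * (suc L * suc L) * e      ∎
  where
  open ≤-Reasoning
  n≤m[L+1] : suc (m * L) ≤ m * suc L
  n≤m[L+1] = subst (suc (m * L) ≤_) (sym (*-suc m L)) (+-monoˡ-≤ (m * L) 1≤m)

mainTheorem3 : (k : ℕ) → 2 ≤ k →
  Σ ℕ λ d → (m : ℕ) → 1 ≤ m →
    IsKGraph k (spider k m) × IsTree 1 (spider k m) ×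
    ((H : Hypergraph) → IsKGraph k H → Arrows H (spider k m) →
      armOrder k m ^ 2 ≤ d * e[ H ])
mainTheorem3 (suc zero) (s≤s ())
mainTheorem3 (suc (suc q)) _ = k * (suc L * suc L) , λ m 1≤m →
  let open Spider q m using (spider-isKGraph; spider-isTree; spider-lowerBound) in
  spider-isKGraph , spider-isTree ,
  λ H (sizes , _) arrows → order²-bound L k 1≤m (spider-lowerBound sizes 1≤m arrows)
  where
  k = suc (suc q)
  L = 2 * k ∸ 2
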